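{- Let $\alpha$ be a composition of $n$ of length $k+1$. Then the dual immaculate quasisymmetric function $\mathfrak{S}^*_\alpha$ is a symmetric function if and only if $\alpha=(n-k,1^k)$, i.e. $\alpha=(n-k,1,1,\dots,1)$ with $k$ parts equal to $1$.
   Context: Diagrams use the French convention: the diagram of $\alpha=(\alpha_1,\dots,\alpha_\ell)$ has left-justified rows, row $j$ from the bottom containing $\alpha_j$ cells. An immaculate tableau of shape $\alpha$ is a filling of the diagram with positive integers whose rows weakly increase from left to right and whose leftmost column strictly increases from bottom to top. The dual immaculate quasisymmetric function is $\mathfrak{S}^*_\alpha=\sum_U x^U$, summed over all immaculate tableaux $U$ of shape $\alpha$, where $x^U=\prod_i x_i^{v_i}$ and $v_i$ is the number of entries equal to $i$. -}

module Defs where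

open import Data.Nat using (ℕ; zero; suc; _<_)
import Data.Nat as ℕ
open import Data.Fin using (Fin) renaming (_≤_ to _≤ᶠ_; _<_ to _<ᶠ_)
open import Data.Fin.Properties using () renaming (_≤?_ to _≤ᶠ?_; _<?_ to _<ᶠ?_; _≟_ to _≟ᶠ_)
open import Data.Fin.Permutation using (Permutation′; _⟨$⟩ʳ_)
open import Data.Vec using (Vec; []; _∷_; lookup; tabulate; toList)
import Data.Vec.Properties as VecP
open import Data.List using (List; []; _∷_; [_]; length; filter; concatMap; map; allFin; _++_)
open import Data.Nat.ListAction using (sum)
open import Data.List.Relation.Unary.All using (All)
open import Data.List.Relation.Unary.Linked using (Linked; linked?)
open import Data.Product using (_×_)
open import Relation.Nullary using (Dec; yes; no)
open import Relation.Nullary.Decidable using (_×-dec_)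
open import Relation.Binary.PropositionalEquality using (_≡_)

IsCompositionOf : ℕ → List ℕ → Set
IsCompositionOf n α = All (0 <_) α × sum α ≡ n

-- A filling of the diagram of α (French convention: the first list entry is the
-- bottom row) with entries from {1,…,m}, encoded as Fin m (i ↦ i+1).
data Filling (m : ℕ) : List ℕ → Set where
  []  : Filling m []
  _∷_ : ∀ {a as} → Vec (Fin m) a → Filling m as → Filling m (a ∷ as)

firstColumn : ∀ {m α} → Filling m α → List (Fin m)
firstColumn [] = []
firstColumn ([] ∷ U) = firstColumn U
firstColumn ((x ∷ _) ∷ U) = x ∷ firstColumn U

RowsWeaklyIncrease : ∀ {m α} → Filling m α → Set
RowsWeaklyIncrease [] = Data.Unit.⊤
  where import Data.Unit
RowsWeaklyIncrease (r ∷ U) = Linked _≤ᶠ_ (toList r) × RowsWeaklyIncrease U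

IsImmaculate : ∀ {m α} → Filling m α → Set
IsImmaculate U = RowsWeaklyIncrease U × Linked _<ᶠ_ (firstColumn U)

rows? : ∀ {m α} (U : Filling m α) → Dec (RowsWeaklyIncrease U)
rows? [] = yes Data.Unit.tt
  where import Data.Unit
rows? (r ∷ U) = linked? _≤ᶠ?_ (toList r) ×-dec rows? U

immaculate? : ∀ {m α} (U : Filling m α) → Dec (IsImmaculate U)
immaculate? U = rows? U ×-dec linked? _<ᶠ?_ (firstColumn U)

entries : ∀ {m α} → Filling m α → List (Fin m)
entries [] = []
entries (r ∷ U) = toList r ++ entries U

-- content: i-th component = number of entries equal to i (exponent of x_{i+1} in x^U)
content : ∀ {m α} → Filling m α → Vec ℕ m
content U = tabulate (λ i → length (filter (_≟ᶠ i) (entries U)))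

allVecs : (m k : ℕ) → List (Vec (Fin m) k)
allVecs m zero = [ [] ]
allVecs m (suc k) = concatMap (λ x → map (x ∷_) (allVecs m k)) (allFin m)

allFillings : (m : ℕ) (α : List ℕ) → List (Filling m α)
allFillings m [] = [ [] ]
allFillings m (a ∷ α) = concatMap (λ r → map (r ∷_) (allFillings m α)) (allVecs m a)

-- A formal power series in x_1, x_2, … with ℕ coefficients, given by its coefficient
-- function: f m v is the coefficient of x_1^{v_1} ⋯ x_m^{v_m}.
Series : Set
Series = (m : ℕ) → Vec ℕ m → ℕ

-- The dual immaculate function 𝔖*_α: coefficient of x^v is the number of immaculate
-- tableaux U of shape α with x^U = x^v (such U only use entries 1,…,m).
dualImmaculate : List ℕ → Series
dualImmaculate α m v =
  length (filter (λ U → immaculate? U ×-dec VecP.≡-dec ℕ._≟_ (content U) v) (allFillings m α))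

-- f is symmetric: invariant under every permutation of the variables, i.e. the
-- coefficient of x^v equals that of x^{v∘σ} for every permutation σ of finitely
-- many variables (every monomial involves only finitely many variables).
IsSymmetric : Series → Set
IsSymmetric f = ∀ m (v : Vec ℕ m) (σ : Permutation′ m) →
  f m v ≡ f m (tabulate (λ i → lookup v (σ ⟨$⟩ʳ i)))

-- For a hook α = (a+1, 1^k), an immaculate tableau of content v has the least variable μ occurring
-- in v in its corner; the column above is a k-subset of the support of v without μ, and it
-- determines the bottom row. So the coefficient of x^v is (|supp v| - 1 choose k) if |v| = n and 0
-- otherwise, which does not change when the variables are permuted. If α is not a hook, its bottom
-- row has fewer than n - k cells, so x_1^(n-k) x_2 ⋯ x_(k+1) has coefficient 0 (an entry 1 can only
-- occur in the bottom row), while x_1 ⋯ x_k x_(k+1)^(n-k) is the content of the tableau whose first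
-- column is 1, …, k+1 and whose other cells all hold k+1.
module Submission where

open import Defs
open import Data.Empty using (⊥-elim)
open import Data.Fin using (Fin; zero; suc; toℕ; fromℕ) renaming (_≤_ to _≤ᶠ_; _<_ to _<ᶠ_)
open import Data.Fin.Permutation using (Permutation′; _⟨$⟩ʳ_; transpose)
open import Data.Fin.Properties using (suc-injective) renaming (_≟_ to _≟ᶠ_; _≤?_ to _≤ᶠ?_)
import Data.Fin.Properties as FinP
open import Data.List
  using (List; []; _∷_; length; filter; map; concatMap; cartesianProductWith; _++_; allFin; replicate)
import Data.List.Properties as Listₚ
open import Data.List.Membership.Propositional using (_∈_)
open import Data.List.Membership.Propositional.Properties
  using (∈-filter⁺; ∈-filter⁻; ∈-allFin; ∈-cartesianProductWith⁺)
open import Data.List.Relation.Unary.All as All using (All; []; _∷_)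
import Data.List.Relation.Unary.All.Properties as Allₚ
open import Data.List.Relation.Unary.AllPairs using ([]; _∷_)
open import Data.List.Relation.Unary.Any as Any using (here; there; _─_)
open import Data.List.Relation.Unary.Linked as Linked using (Linked; []; [-]; _∷_)
import Data.List.Relation.Unary.Linked.Properties as Linkedₚ
open import Data.List.Relation.Unary.Unique.Propositional using (Unique)
import Data.List.Relation.Unary.Unique.Propositional.Properties as Uniqueₚ
open import Data.Nat using (ℕ; zero; suc; _+_; _∸_; _≤_; _<_; z≤n; s≤s)
import Data.Nat as ℕ
open import Data.Nat.Combinatorics using (_C_; nCk+nC[k+1]≡[n+1]C[k+1])
open import Data.Nat.ListAction using (sum)
import Data.Nat.Properties as ℕₚ
open import Data.Product using (_×_; _,_; proj₁; proj₂; ∃-syntax)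
open import Data.Vec using (Vec; []; _∷_; lookup; tabulate; toList)
import Data.Vec as Vec
import Data.Vec.Properties as Vecₚ
open import Function using (_∘_)
open import Function.Bundles using (_⇔_; mk⇔)
open import Level using (0ℓ)
open import Relation.Binary using (Rel; Transitive)
open import Relation.Binary.PropositionalEquality
open import Relation.Nullary using (¬_; yes; no)
open import Relation.Nullary.Decidable using (_×-dec_)
open import Relation.Unary using (Pred; Decidable)

open import Algebra.Properties.CommutativeSemigroup ℕₚ.+-commutativeSemigroup using (x∙yz≈y∙xz)
open import Algebra.Properties.CommutativeMonoid.Sum ℕₚ.+-0-commutativeMonoid
  using (∑-distrib-+; sum-permute; sum-cong-≗; sum-replicate-zero) renaming (sum to ∑)

module _ {A : Set} where

  ∈-─⁺ : ∀ {x z : A} {ys} (x∈ys : x ∈ ys) → z ∈ ys → z ≢ x → z ∈ (ys ─ x∈ys)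
  ∈-─⁺ (here refl) (here refl) z≢x = ⊥-elim (z≢x refl)
  ∈-─⁺ (here refl) (there z∈ys) _ = z∈ys
  ∈-─⁺ (there x∈ys) (here refl) _ = here refl
  ∈-─⁺ (there x∈ys) (there z∈ys) z≢x = there (∈-─⁺ x∈ys z∈ys z≢x)

module _ {A B : Set} (f : A → B) where

  length-≤-injection : ∀ {xs : List A} {ys : List B} → Unique xs →
    (∀ {x} → x ∈ xs → f x ∈ ys) → (∀ {x y} → x ∈ xs → y ∈ xs → f x ≡ f y → x ≡ y) →
    length xs ≤ length ys
  length-≤-injection {[]} _ _ _ = z≤n
  length-≤-injection {x ∷ xs} {ys} (x∉xs ∷ xs-unique) into injective =
    subst (suc (length xs) ≤_) (sym (Listₚ.length-removeAt′ ys (Any.index fx∈ys)))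
      (s≤s (length-≤-injection xs-unique into′ (λ p q → injective (there p) (there q))))
    where
    fx∈ys = into (here refl)
    into′ : ∀ {z} → z ∈ xs → f z ∈ (ys ─ fx∈ys)
    into′ z∈xs = ∈-─⁺ fx∈ys (into (there z∈xs))
      (λ fz≡fx → All.lookup x∉xs z∈xs (sym (injective (there z∈xs) (here refl) fz≡fx)))

module _ {A B : Set} {P : Pred A 0ℓ} {Q : Pred B 0ℓ} (P? : Decidable P) (Q? : Decidable Q) where

  length-filter-≤-retraction : ∀ {xs ys} → Unique xs → (∀ y → y ∈ ys) →
    (f : A → B) (g : B → A) → (∀ {x} → P x → Q (f x)) → (∀ {x} → P x → g (f x) ≡ x) →
    length (filter P? xs) ≤ length (filter Q? ys)
  length-filter-≤-retraction {xs} xs-unique ys-complete f g f-preserves g∘f≡id =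
    length-≤-injection f (Uniqueₚ.filter⁺ P? xs-unique)
      (λ x∈ → ∈-filter⁺ Q? (ys-complete _) (f-preserves (P-of x∈)))
      (λ x∈ y∈ fx≡fy → trans (sym (g∘f≡id (P-of x∈))) (trans (cong g fx≡fy) (g∘f≡id (P-of y∈))))
    where
    P-of : ∀ {x} → x ∈ filter P? xs → P x
    P-of = proj₂ ∘ ∈-filter⁻ P? {xs = xs}

  length-filter-map : ∀ (f : B → A) xs → (∀ {y} → P (f y) → Q y) → (∀ {y} → Q y → P (f y)) →
    length (filter P? (map f xs)) ≡ length (filter Q? xs)
  length-filter-map f [] _ _ = refl
  length-filter-map f (y ∷ ys) P→Q Q→P with P? (f y) | Q? y
  ... | yes _   | yes _  = cong suc (length-filter-map f ys P→Q Q→P)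
  ... | no _    | no _   = length-filter-map f ys P→Q Q→P
  ... | yes pfy | no ¬qy = ⊥-elim (¬qy (P→Q pfy))
  ... | no ¬pfy | yes qy = ⊥-elim (¬pfy (Q→P qy))

length-filter-≡-bijection : ∀ {A B : Set} {P : Pred A 0ℓ} {Q : Pred B 0ℓ}
  (P? : Decidable P) (Q? : Decidable Q) {xs : List A} {ys : List B} →
  Unique xs → Unique ys → (∀ x → x ∈ xs) → (∀ y → y ∈ ys) →
  (f : A → B) (g : B → A) → (∀ {x} → P x → Q (f x)) → (∀ {y} → Q y → P (g y)) →
  (∀ {x} → P x → g (f x) ≡ x) → (∀ {y} → Q y → f (g y) ≡ y) →
  length (filter P? xs) ≡ length (filter Q? ys)
length-filter-≡-bijection P? Q? xs-unique ys-unique xs-complete ys-complete f g fP gQ gf fg =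
  ℕₚ.≤-antisym (length-filter-≤-retraction P? Q? xs-unique ys-complete f g fP gf)
               (length-filter-≤-retraction Q? P? ys-unique xs-complete g f gQ fg)

length-filter-none : ∀ {A : Set} {P : Pred A 0ℓ} (P? : Decidable P) {xs} → All (¬_ ∘ P) xs →
  length (filter P? xs) ≡ 0
length-filter-none P? none = cong length (Listₚ.filter-none P? none)

length-filter-++ : ∀ {A : Set} {P : Pred A 0ℓ} (P? : Decidable P) xs ys →
  length (filter P? (xs ++ ys)) ≡ length (filter P? xs) + length (filter P? ys)
length-filter-++ P? xs ys =
  trans (cong length (Listₚ.filter-++ P? xs ys)) (Listₚ.length-++ (filter P? xs))

concatMap-map≡cartesianProductWith : ∀ {A B C : Set} (f : A → B → C) xs ys →
  concatMap (λ x → map (f x) ys) xs ≡ cartesianProductWith f xs ys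
concatMap-map≡cartesianProductWith f [] ys = refl
concatMap-map≡cartesianProductWith f (x ∷ xs) ys =
  cong (map (f x) ys ++_) (concatMap-map≡cartesianProductWith f xs ys)

allVecs-suc : ∀ m k → allVecs m (suc k) ≡ cartesianProductWith _∷_ (allFin m) (allVecs m k)
allVecs-suc m k = concatMap-map≡cartesianProductWith _∷_ (allFin m) (allVecs m k)

∈-allVecs : ∀ {m k} (v : Vec (Fin m) k) → v ∈ allVecs m k
∈-allVecs [] = here refl
∈-allVecs {m} {suc k} (x ∷ v) rewrite allVecs-suc m k =
  ∈-cartesianProductWith⁺ _∷_ (∈-allFin x) (∈-allVecs v)

allVecs-unique : ∀ m k → Unique (allVecs m k)
allVecs-unique m zero = [] ∷ []
allVecs-unique m (suc k) rewrite allVecs-suc m k =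
  Uniqueₚ.cartesianProductWith⁺ _∷_ Vecₚ.∷-injective (Uniqueₚ.allFin⁺ m) (allVecs-unique m k)

allFillings-cons : ∀ m a α →
  allFillings m (a ∷ α) ≡ cartesianProductWith _∷_ (allVecs m a) (allFillings m α)
allFillings-cons m a α = concatMap-map≡cartesianProductWith _∷_ (allVecs m a) (allFillings m α)

∈-allFillings : ∀ {m α} (U : Filling m α) → U ∈ allFillings m α
∈-allFillings [] = here refl
∈-allFillings {m} {a ∷ α} (r ∷ U) rewrite allFillings-cons m a α =
  ∈-cartesianProductWith⁺ _∷_ (∈-allVecs r) (∈-allFillings U)

Filling-∷-injective : ∀ {m a α} {r r′ : Vec (Fin m) a} {U U′ : Filling m α} →
  _≡_ {A = Filling m (a ∷ α)} (r ∷ U) (r′ ∷ U′) → r ≡ r′ × U ≡ U′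
Filling-∷-injective refl = refl , refl

allFillings-unique : ∀ m α → Unique (allFillings m α)
allFillings-unique m [] = [] ∷ []
allFillings-unique m (a ∷ α) rewrite allFillings-cons m a α =
  Uniqueₚ.cartesianProductWith⁺ _∷_ Filling-∷-injective (allVecs-unique m a) (allFillings-unique m α)

module _ {A : Set} {R : Rel A 0ℓ} where

  Linked⇒All-head : Transitive R → ∀ {x xs} → Linked R (x ∷ xs) → All (R x) xs
  Linked⇒All-head trans linked with Linkedₚ.Linked⇒AllPairs trans linked
  ... | R-head ∷ _ = R-head

  All-head∷Linked : ∀ {x xs} → All (R x) xs → Linked R xs → Linked R (x ∷ xs)
  All-head∷Linked [] [] = [-]
  All-head∷Linked (Rxy ∷ _) linked = Rxy ∷ linked

map-suc-Linked : ∀ {m} {R : Rel (Fin m) 0ℓ} {R′ : Rel (Fin (suc m)) 0ℓ} →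
  (∀ {x y} → R x y → R′ (suc x) (suc y)) → ∀ {xs} → Linked R xs → Linked R′ (map suc xs)
map-suc-Linked R⇒R′ = Linkedₚ.map⁺ ∘ Linked.map R⇒R′

count : ∀ {m} → Fin m → List (Fin m) → ℕ
count i xs = length (filter (_≟ᶠ i) xs)

multiplicities : ∀ {m} → List (Fin m) → Vec ℕ m
multiplicities xs = tabulate (λ i → count i xs)

lookup-multiplicities : ∀ {m} (xs : List (Fin m)) i → lookup (multiplicities xs) i ≡ count i xs
lookup-multiplicities xs = Vecₚ.lookup∘tabulate (λ i → count i xs)

multiplicities-≡ : ∀ {m} (xs : List (Fin m)) {c : Vec ℕ m} → (∀ i → count i xs ≡ lookup c i) →
  multiplicities xs ≡ c
multiplicities-≡ xs {c} count≡ = trans (Vecₚ.tabulate-cong count≡) (Vecₚ.tabulate∘lookup c)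

count-++ : ∀ {m} (i : Fin m) xs ys → count i (xs ++ ys) ≡ count i xs + count i ys
count-++ i xs ys =
  trans (cong length (Listₚ.filter-++ (_≟ᶠ i) xs ys)) (Listₚ.length-++ (filter (_≟ᶠ i) xs))

count-≡ : ∀ {m} (i : Fin m) xs → count i (i ∷ xs) ≡ suc (count i xs)
count-≡ i xs = cong length (Listₚ.filter-accept (_≟ᶠ i) refl)

count-≢ : ∀ {m} {i x : Fin m} xs → x ≢ i → count i (x ∷ xs) ≡ count i xs
count-≢ xs x≢i = cong length (Listₚ.filter-reject (_≟ᶠ _) x≢i)

count-absent : ∀ {m} {i : Fin m} {xs} → All (_≢ i) xs → count i xs ≡ 0
count-absent = length-filter-none (_≟ᶠ _)

count-below-all : ∀ {m} {i : Fin m} {xs} → All (i <ᶠ_) xs → count i xs ≡ 0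
count-below-all = count-absent ∘ All.map (λ i<y y≡i → FinP.<⇒≢ i<y (sym y≡i))

count-replicate-≡ : ∀ {m} (i : Fin m) t → count i (replicate t i) ≡ t
count-replicate-≡ i t = trans (cong length (Listₚ.filter-all (_≟ᶠ i) (Allₚ.replicate⁺ t refl)))
  (Listₚ.length-replicate t)

count-replicate-≢ : ∀ {m} {i x : Fin m} t → x ≢ i → count i (replicate t x) ≡ 0
count-replicate-≢ t x≢i = count-absent (Allₚ.replicate⁺ t x≢i)

count-replicate-+ : ∀ {m} (i y : Fin m) s t →
  count i (replicate (s + t) y) ≡ count i (replicate s y) + count i (replicate t y)
count-replicate-+ i y s t with y ≟ᶠ i
... | yes refl = trans (count-replicate-≡ i (s + t))
                       (sym (cong₂ _+_ (count-replicate-≡ i s) (count-replicate-≡ i t)))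
... | no y≢i = trans (count-replicate-≢ (s + t) y≢i)
                     (sym (cong₂ _+_ (count-replicate-≢ s y≢i) (count-replicate-≢ t y≢i)))

count-map-suc : ∀ {m} (i : Fin m) xs → count (suc i) (map suc xs) ≡ count i xs
count-map-suc i xs = length-filter-map (_≟ᶠ suc i) (_≟ᶠ i) suc xs suc-injective (cong suc)

count-zero-map-suc : ∀ {m} (xs : List (Fin m)) → count zero (map suc xs) ≡ 0
count-zero-map-suc xs = count-absent (Allₚ.map⁺ (All.universal (λ _ ()) xs))

∈⇒count-pos : ∀ {m} {i : Fin m} {xs} → i ∈ xs → 0 < count i xs
∈⇒count-pos i∈xs = Listₚ.filter-some (_≟ᶠ _) (Any.map sym i∈xs)

count-pos⇒∈ : ∀ {m} {i : Fin m} xs → 0 < count i xs → i ∈ xs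
count-pos⇒∈ {i = i} (x ∷ xs) pos with x ≟ᶠ i
... | yes refl = here refl
... | no _ = there (count-pos⇒∈ xs pos)

∑-count-singleton : ∀ {m} (x : Fin m) → ∑ (λ i → count i (x ∷ [])) ≡ 1
∑-count-singleton {suc m} zero = cong suc (sum-replicate-zero m)
∑-count-singleton (suc x) = trans (sum-cong-≗ (λ i → count-map-suc i (x ∷ []))) (∑-count-singleton x)

∑-count : ∀ {m} (xs : List (Fin m)) → ∑ (λ i → count i xs) ≡ length xs
∑-count {m} [] = sum-replicate-zero m
∑-count (x ∷ xs) = begin
  ∑ (λ i → count i (x ∷ xs))
    ≡⟨ sum-cong-≗ (λ i → count-++ i (x ∷ []) xs) ⟩
  ∑ (λ i → count i (x ∷ []) + count i xs)
    ≡⟨ ∑-distrib-+ (λ i → count i (x ∷ [])) (λ i → count i xs) ⟩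
  ∑ (λ i → count i (x ∷ [])) + ∑ (λ i → count i xs)
    ≡⟨ cong₂ _+_ (∑-count-singleton x) (∑-count xs) ⟩
  suc (length xs) ∎
  where open ≡-Reasoning

∑-multiplicities : ∀ {m} (xs : List (Fin m)) → ∑ (lookup (multiplicities xs)) ≡ length xs
∑-multiplicities xs = trans (sum-cong-≗ (lookup-multiplicities xs)) (∑-count xs)

count-∷-++ : ∀ {m} (i x : Fin m) ys zs → count i (x ∷ ys ++ zs) ≡ count i ys + count i (x ∷ zs)
count-∷-++ i x ys zs = begin
  count i (x ∷ ys ++ zs)                         ≡⟨ count-++ i (x ∷ []) (ys ++ zs) ⟩
  count i (x ∷ []) + count i (ys ++ zs)          ≡⟨ cong (count i (x ∷ []) +_) (count-++ i ys zs) ⟩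
  count i (x ∷ []) + (count i ys + count i zs)   ≡⟨ x∙yz≈y∙xz (count i (x ∷ [])) (count i ys) _ ⟩
  count i ys + (count i (x ∷ []) + count i zs)   ≡⟨ cong (count i ys +_) (count-++ i (x ∷ []) zs) ⟨
  count i ys + count i (x ∷ zs)                  ∎
  where open ≡-Reasoning

strict⇒count≤1 : ∀ {m} {xs : List (Fin m)} i → Linked _<ᶠ_ xs → count i xs ≤ 1
strict⇒count≤1 {xs = []} i _ = z≤n
strict⇒count≤1 {xs = x ∷ xs} i strict with x ≟ᶠ i
... | yes refl = s≤s (ℕₚ.≤-reflexive (count-below-all (Linked⇒All-head FinP.<-trans strict)))
... | no _ = strict⇒count≤1 i (Linked.tail strict)

toList-allFin-suc : ∀ n → toList (Vec.allFin (suc n)) ≡ zero ∷ map suc (toList (Vec.allFin n))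
toList-allFin-suc n =
  cong (zero ∷_) (trans (cong toList (Vecₚ.tabulate-∘ suc (λ i → i))) (Vecₚ.toList-map suc _))

allFin-strict : ∀ n → Linked _<ᶠ_ (toList (Vec.allFin n))
allFin-strict zero = []
allFin-strict (suc n) = subst (Linked _<ᶠ_) (sym (toList-allFin-suc n))
  (All-head∷Linked (Allₚ.map⁺ (All.universal (λ _ → s≤s z≤n) _)) (map-suc-Linked s≤s (allFin-strict n)))

count-allFin : ∀ n (i : Fin n) → count i (toList (Vec.allFin n)) ≡ 1
count-allFin (suc n) zero = begin
  count zero (toList (Vec.allFin (suc n)))        ≡⟨ cong (count zero) (toList-allFin-suc n) ⟩
  suc (count zero (map suc (toList (Vec.allFin n)))) ≡⟨ cong suc (count-zero-map-suc (toList (Vec.allFin n))) ⟩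
  1                                               ∎
  where open ≡-Reasoning
count-allFin (suc n) (suc i) = begin
  count (suc i) (toList (Vec.allFin (suc n)))     ≡⟨ cong (count (suc i)) (toList-allFin-suc n) ⟩
  count (suc i) (map suc (toList (Vec.allFin n))) ≡⟨ count-map-suc i (toList (Vec.allFin n)) ⟩
  count i (toList (Vec.allFin n))                 ≡⟨ count-allFin n i ⟩
  1                                               ∎
  where open ≡-Reasoning

fromMultiplicities : ∀ {m} → Vec ℕ m → List (Fin m)
fromMultiplicities [] = []
fromMultiplicities (c ∷ cs) = replicate c zero ++ map suc (fromMultiplicities cs)

count-fromMultiplicities : ∀ {m} (c : Vec ℕ m) i → count i (fromMultiplicities c) ≡ lookup c i
count-fromMultiplicities (c ∷ cs) zero = begin
  count zero (fromMultiplicities (c ∷ cs))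
    ≡⟨ count-++ zero (replicate c zero) (map suc (fromMultiplicities cs)) ⟩
  count zero (replicate c zero) + count zero (map suc (fromMultiplicities cs))
    ≡⟨ cong₂ _+_ (count-replicate-≡ zero c) (count-zero-map-suc (fromMultiplicities cs)) ⟩
  c + 0 ≡⟨ ℕₚ.+-identityʳ c ⟩
  c ∎
  where open ≡-Reasoning
count-fromMultiplicities (c ∷ cs) (suc i) = begin
  count (suc i) (fromMultiplicities (c ∷ cs))
    ≡⟨ count-++ (suc i) (replicate c zero) (map suc (fromMultiplicities cs)) ⟩
  count (suc i) (replicate c zero) + count (suc i) (map suc (fromMultiplicities cs))
    ≡⟨ cong₂ _+_ (count-replicate-≢ c (λ ())) (count-map-suc i (fromMultiplicities cs)) ⟩
  count i (fromMultiplicities cs) ≡⟨ count-fromMultiplicities cs i ⟩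
  lookup cs i ∎
  where open ≡-Reasoning

multiplicities-fromMultiplicities : ∀ {m} (c : Vec ℕ m) → multiplicities (fromMultiplicities c) ≡ c
multiplicities-fromMultiplicities c = multiplicities-≡ (fromMultiplicities c) (count-fromMultiplicities c)

length-fromMultiplicities : ∀ {m} (c : Vec ℕ m) → length (fromMultiplicities c) ≡ ∑ (lookup c)
length-fromMultiplicities [] = refl
length-fromMultiplicities (c ∷ cs) = begin
  length (replicate c zero ++ map suc (fromMultiplicities cs))
    ≡⟨ Listₚ.length-++ (replicate c zero) ⟩
  length (replicate c zero) + length (map suc (fromMultiplicities cs))
    ≡⟨ cong₂ _+_ (Listₚ.length-replicate c) (Listₚ.length-map suc (fromMultiplicities cs)) ⟩
  c + length (fromMultiplicities cs) ≡⟨ cong (c +_) (length-fromMultiplicities cs) ⟩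
  c + ∑ (lookup cs) ∎
  where open ≡-Reasoning

fromMultiplicities-sorted : ∀ {m} (c : Vec ℕ m) → Linked _≤ᶠ_ (fromMultiplicities c)
fromMultiplicities-sorted [] = []
fromMultiplicities-sorted (zero ∷ cs) = map-suc-Linked s≤s (fromMultiplicities-sorted cs)
fromMultiplicities-sorted (suc c ∷ cs) =
  All-head∷Linked (All.universal (λ _ → z≤n) _) (fromMultiplicities-sorted (c ∷ cs))

fromMultiplicities-strict : ∀ {m} (c : Vec ℕ m) → (∀ i → lookup c i ≤ 1) →
  Linked _<ᶠ_ (fromMultiplicities c)
fromMultiplicities-strict [] _ = []
fromMultiplicities-strict (zero ∷ cs) c≤1 =
  map-suc-Linked s≤s (fromMultiplicities-strict cs (c≤1 ∘ suc))
fromMultiplicities-strict (suc zero ∷ cs) c≤1 =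
  All-head∷Linked (Allₚ.map⁺ (All.universal (λ _ → s≤s z≤n) _))
    (map-suc-Linked s≤s (fromMultiplicities-strict cs (c≤1 ∘ suc)))
fromMultiplicities-strict (suc (suc _) ∷ cs) c≤1 with c≤1 zero
... | s≤s ()

multiplicities-map-suc : ∀ {m} (xs : List (Fin m)) → multiplicities (map suc xs) ≡ 0 ∷ multiplicities xs
multiplicities-map-suc xs =
  cong₂ _∷_ (count-zero-map-suc xs) (Vecₚ.tabulate-cong (λ i → count-map-suc i xs))

fromMultiplicities-zeros : ∀ m → fromMultiplicities (multiplicities {m} []) ≡ []
fromMultiplicities-zeros zero = refl
fromMultiplicities-zeros (suc m) = cong (map suc) (fromMultiplicities-zeros m)

sorted-suc-head : ∀ {m} {y : Fin m} {xs} → Linked _≤ᶠ_ (suc y ∷ xs) →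
  ∃[ ys ] map suc ys ≡ xs × Linked _≤ᶠ_ (y ∷ ys)
sorted-suc-head {xs = []} [-] = [] , refl , [-]
sorted-suc-head {xs = suc z ∷ xs} (s≤s y≤z ∷ sorted) with sorted-suc-head sorted
... | ys , refl , ys-sorted = z ∷ ys , refl , y≤z ∷ ys-sorted

fromMultiplicities-multiplicities : ∀ {m} {xs : List (Fin m)} → Linked _≤ᶠ_ xs →
  fromMultiplicities (multiplicities xs) ≡ xs
fromMultiplicities-multiplicities {m} {[]} _ = fromMultiplicities-zeros m
fromMultiplicities-multiplicities {xs = zero ∷ xs} sorted =
  cong (zero ∷_) (fromMultiplicities-multiplicities (Linked.tail sorted))
fromMultiplicities-multiplicities {xs = suc y ∷ xs} sorted with sorted-suc-head sorted
... | ys , refl , ys-sorted = begin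
  fromMultiplicities (multiplicities (map suc (y ∷ ys)))
    ≡⟨ cong fromMultiplicities (multiplicities-map-suc (y ∷ ys)) ⟩
  map suc (fromMultiplicities (multiplicities (y ∷ ys)))
    ≡⟨ cong (map suc) (fromMultiplicities-multiplicities ys-sorted) ⟩
  map suc (y ∷ ys) ∎
  where open ≡-Reasoning

bit : ℕ → Fin 2
bit zero = zero
bit (suc _) = suc zero

support : ∀ {m} → Vec ℕ m → Vec (Fin 2) m
support = Vec.map bit

weight : ∀ {m} → Vec (Fin 2) m → ℕ
weight w = ∑ (lookup (Vec.map toℕ w))

toℕ-bit≤ : ∀ c → toℕ (bit c) ≤ c
toℕ-bit≤ zero = z≤n
toℕ-bit≤ (suc c) = s≤s z≤n

bit-mono : ∀ {c c′} → c ≤ c′ → bit c ≤ᶠ bit c′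
bit-mono {zero} _ = z≤n
bit-mono {suc c} (s≤s _) = s≤s z≤n

bit-toℕ : ∀ (b : Fin 2) → bit (toℕ b) ≡ b
bit-toℕ zero = refl
bit-toℕ (suc zero) = refl

toℕ-support : ∀ {m} (c : Vec ℕ m) → (∀ i → lookup c i ≤ 1) → Vec.map toℕ (support c) ≡ c
toℕ-support [] _ = refl
toℕ-support (c ∷ cs) c≤1 = cong₂ _∷_ (toℕ-bit (c≤1 zero)) (toℕ-support cs (c≤1 ∘ suc))
  where
  toℕ-bit : ∀ {c} → c ≤ 1 → toℕ (bit c) ≡ c
  toℕ-bit z≤n = refl
  toℕ-bit (s≤s z≤n) = refl

support-toℕ : ∀ {m} (w : Vec (Fin 2) m) → support (Vec.map toℕ w) ≡ w
support-toℕ w = trans (sym (Vecₚ.map-∘ bit toℕ w)) (trans (Vecₚ.map-cong bit-toℕ w) (Vecₚ.map-id w))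

strict⇒toℕ-support-multiplicities : ∀ {m} {xs : List (Fin m)} → Linked _<ᶠ_ xs →
  Vec.map toℕ (support (multiplicities xs)) ≡ multiplicities xs
strict⇒toℕ-support-multiplicities {xs = xs} strict =
  toℕ-support (multiplicities xs)
    (λ i → subst (_≤ 1) (sym (lookup-multiplicities xs i)) (strict⇒count≤1 i strict))

weight-[]≔zero : ∀ {m} (w : Vec (Fin 2) m) i → weight w ≡ toℕ (lookup w i) + weight (w Vec.[ i ]≔ zero)
weight-[]≔zero (b ∷ w) zero = refl
weight-[]≔zero (b ∷ w) (suc i) =
  trans (cong (toℕ b +_) (weight-[]≔zero w i)) (x∙yz≈y∙xz (toℕ b) (toℕ (lookup w i)) _)

weight-support : ∀ {m} (v : Vec ℕ m) → weight (support v) ≡ ∑ (λ i → toℕ (bit (lookup v i)))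
weight-support v = sum-cong-≗ λ i →
  trans (Vecₚ.lookup-map i toℕ (support v)) (cong toℕ (Vecₚ.lookup-map i bit v))

IsSubsetOfSize : ∀ {m} → Vec (Fin 2) m → ℕ → Vec (Fin 2) m → Set
IsSubsetOfSize X k w = (∀ i → lookup w i ≤ᶠ lookup X i) × weight w ≡ k

isSubsetOfSize? : ∀ {m} (X : Vec (Fin 2) m) k → Decidable (IsSubsetOfSize X k)
isSubsetOfSize? X k w = FinP.all? (λ i → lookup w i ≤ᶠ? lookup X i) ×-dec (weight w ℕ.≟ k)

subsetsOfSize : ∀ {m} → Vec (Fin 2) m → ℕ → List (Vec (Fin 2) m)
subsetsOfSize X k = filter (isSubsetOfSize? X k) (allVecs 2 _)

module _ {m} (X : Vec (Fin 2) m) where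

  #subsetsOfSize-zero∷ : ∀ x k →
    length (filter (isSubsetOfSize? (x ∷ X) k) (map (zero ∷_) (allVecs 2 m))) ≡ length (subsetsOfSize X k)
  #subsetsOfSize-zero∷ x k =
    length-filter-map (isSubsetOfSize? (x ∷ X) k) (isSubsetOfSize? X k) (zero ∷_) (allVecs 2 m)
      (λ (⊆ , size) → ⊆ ∘ suc , size)
      (λ (⊆ , size) → (λ { zero → z≤n ; (suc i) → ⊆ i }) , size)

  #subsetsOfSize-one∷ : ∀ k →
    length (filter (isSubsetOfSize? (suc zero ∷ X) (suc k)) (map (suc zero ∷_) (allVecs 2 m)))
      ≡ length (subsetsOfSize X k)
  #subsetsOfSize-one∷ k =
    length-filter-map (isSubsetOfSize? (suc zero ∷ X) (suc k)) (isSubsetOfSize? X k) (suc zero ∷_) (allVecs 2 m)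
      (λ (⊆ , size) → ⊆ ∘ suc , ℕₚ.suc-injective size)
      (λ (⊆ , size) → (λ { zero → s≤s z≤n ; (suc i) → ⊆ i }) , cong suc size)

  #subsetsOfSize-one∷-outside : ∀ k →
    length (filter (isSubsetOfSize? (zero ∷ X) k) (map (suc zero ∷_) (allVecs 2 m))) ≡ 0
  #subsetsOfSize-one∷-outside k =
    length-filter-none _ (Allₚ.map⁺ (All.universal (λ _ (⊆ , _) → ℕₚ.n≮0 (⊆ zero)) (allVecs 2 m)))

  #subsetsOfSize-one∷-empty :
    length (filter (isSubsetOfSize? (suc zero ∷ X) 0) (map (suc zero ∷_) (allVecs 2 m))) ≡ 0
  #subsetsOfSize-one∷-empty = length-filter-none _ (Allₚ.map⁺ (All.universal (λ _ ()) (allVecs 2 m)))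

#subsetsOfSize : ∀ {m} (X : Vec (Fin 2) m) k → length (subsetsOfSize X k) ≡ weight X C k
#subsetsOfSize [] zero = refl
#subsetsOfSize [] (suc k) = refl
#subsetsOfSize {suc m} (x ∷ X) k = begin
  length (filter (isSubsetOfSize? (x ∷ X) k) (with-zero ++ with-one ++ []))
    ≡⟨ length-filter-++ (isSubsetOfSize? (x ∷ X) k) with-zero (with-one ++ []) ⟩
  length (filter (isSubsetOfSize? (x ∷ X) k) with-zero)
    + length (filter (isSubsetOfSize? (x ∷ X) k) (with-one ++ []))
    ≡⟨ cong₂ _+_ (#subsetsOfSize-zero∷ X x k)
                 (cong (length ∘ filter (isSubsetOfSize? (x ∷ X) k)) (Listₚ.++-identityʳ with-one)) ⟩
  length (subsetsOfSize X k) + length (filter (isSubsetOfSize? (x ∷ X) k) with-one)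
    ≡⟨ by-head x k ⟩
  weight (x ∷ X) C k ∎
  where
  open ≡-Reasoning
  with-zero = map (zero ∷_) (allVecs 2 m)
  with-one = map (suc zero ∷_) (allVecs 2 m)
  by-head : ∀ x k → length (subsetsOfSize X k) + length (filter (isSubsetOfSize? (x ∷ X) k) with-one)
                    ≡ weight (x ∷ X) C k
  by-head zero k = begin
    length (subsetsOfSize X k) + length (filter (isSubsetOfSize? (zero ∷ X) k) with-one)
      ≡⟨ cong (length (subsetsOfSize X k) +_) (#subsetsOfSize-one∷-outside X k) ⟩
    length (subsetsOfSize X k) + 0 ≡⟨ ℕₚ.+-identityʳ _ ⟩
    length (subsetsOfSize X k)     ≡⟨ #subsetsOfSize X k ⟩
    weight X C k                   ∎
  by-head (suc zero) zero = begin
    length (subsetsOfSize X 0) + length (filter (isSubsetOfSize? (suc zero ∷ X) 0) with-one)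
      ≡⟨ cong (length (subsetsOfSize X 0) +_) (#subsetsOfSize-one∷-empty X) ⟩
    length (subsetsOfSize X 0) + 0 ≡⟨ ℕₚ.+-identityʳ _ ⟩
    length (subsetsOfSize X 0)     ≡⟨ #subsetsOfSize X 0 ⟩
    1                              ∎
  by-head (suc zero) (suc k) = begin
    length (subsetsOfSize X (suc k)) + length (filter (isSubsetOfSize? (suc zero ∷ X) (suc k)) with-one)
      ≡⟨ cong₂ _+_ (#subsetsOfSize X (suc k)) (trans (#subsetsOfSize-one∷ X k) (#subsetsOfSize X k)) ⟩
    weight X C suc k + weight X C k ≡⟨ ℕₚ.+-comm (weight X C suc k) (weight X C k) ⟩
    weight X C k + weight X C suc k ≡⟨ nCk+nC[k+1]≡[n+1]C[k+1] (weight X) k ⟩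
    suc (weight X) C suc k          ∎

entries-above-bottomLeft : ∀ {m β} {x : Fin m} (U : Filling m β) → RowsWeaklyIncrease U →
  Linked _<ᶠ_ (x ∷ firstColumn U) → All (x <ᶠ_) (entries U)
entries-above-bottomLeft [] _ _ = []
entries-above-bottomLeft ([] ∷ U) (_ , rows) strict = entries-above-bottomLeft U rows strict
entries-above-bottomLeft {x = x} ((y ∷ ys) ∷ U) (row , rows) (x<y ∷ strict) =
  Allₚ.++⁺ (x<y ∷ All.map (ℕₚ.<-≤-trans x<y) (Linked⇒All-head FinP.≤-trans row))
           (entries-above-bottomLeft U rows strict′)
  where
  strict′ : Linked _<ᶠ_ (x ∷ firstColumn U)
  strict′ = All-head∷Linked (All.map (FinP.<-trans x<y) (Linked⇒All-head FinP.<-trans strict))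
                            (Linked.tail strict)

bottomLeft-minimal : ∀ {m a β} {x : Fin m} {r : Vec (Fin m) a} {U : Filling m β} →
  IsImmaculate ((x ∷ r) ∷ U) → All (x ≤ᶠ_) (entries ((x ∷ r) ∷ U))
bottomLeft-minimal {U = U} ((row , rows) , strict) =
  Allₚ.++⁺ (FinP.≤-refl ∷ Linked⇒All-head FinP.≤-trans row)
           (All.map ℕₚ.<⇒≤ (entries-above-bottomLeft U rows strict))

length-entries : ∀ {m α} (U : Filling m α) → length (entries U) ≡ sum α
length-entries [] = refl
length-entries (r ∷ U) = trans (Listₚ.length-++ (toList r))
  (cong₂ _+_ (Vecₚ.length-toList r) (length-entries U))

sum-replicate-1 : ∀ k → sum (replicate k 1) ≡ k
sum-replicate-1 zero = refl
sum-replicate-1 (suc k) = cong suc (sum-replicate-1 k)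

dualImmaculate-≢-degree : ∀ {m} α (v : Vec ℕ m) → ∑ (lookup v) ≢ sum α → dualImmaculate α m v ≡ 0
dualImmaculate-≢-degree {m} α v |v|≢ = length-filter-none _ (All.universal degree-mismatch (allFillings m α))
  where
  degree-mismatch : ∀ U → ¬ (IsImmaculate U × content U ≡ v)
  degree-mismatch U (_ , content≡v) =
    |v|≢ (trans (cong (∑ ∘ lookup) (sym content≡v)) (trans (∑-multiplicities (entries U)) (length-entries U)))

-- The default entry only fills lists that are too short; every list padded below has the right length.
padRow : ∀ {A : Set} → A → (a : ℕ) → List A → Vec A a
padRow d zero _ = []
padRow d (suc a) [] = d ∷ padRow d a []
padRow d (suc a) (x ∷ xs) = x ∷ padRow d a xs

toList-padRow : ∀ {A : Set} (d : A) {a} xs → length xs ≡ a → toList (padRow d a xs) ≡ xs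
toList-padRow d [] refl = refl
toList-padRow d (x ∷ xs) refl = cong (x ∷_) (toList-padRow d xs refl)

padRow-toList : ∀ {A : Set} (d : A) {a} (r : Vec A a) → padRow d a (toList r) ≡ r
padRow-toList d [] = refl
padRow-toList d (x ∷ r) = cong (x ∷_) (padRow-toList d r)

padColumn : ∀ {m} → Fin m → (k : ℕ) → List (Fin m) → Filling m (replicate k 1)
padColumn d zero _ = []
padColumn d (suc k) [] = (d ∷ []) ∷ padColumn d k []
padColumn d (suc k) (x ∷ xs) = (x ∷ []) ∷ padColumn d k xs

entries-padColumn : ∀ {m} (d : Fin m) {k} xs → length xs ≡ k → entries (padColumn d k xs) ≡ xs
entries-padColumn d [] refl = refl
entries-padColumn d (x ∷ xs) refl = cong (x ∷_) (entries-padColumn d xs refl)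

padColumn-entries : ∀ {m} (d : Fin m) {k} (U : Filling m (replicate k 1)) → padColumn d k (entries U) ≡ U
padColumn-entries d {zero} [] = refl
padColumn-entries d {suc k} ((x ∷ []) ∷ U) = cong ((x ∷ []) ∷_) (padColumn-entries d U)

length-entries-column : ∀ {m k} (U : Filling m (replicate k 1)) → length (entries U) ≡ k
length-entries-column {k = zero} [] = refl
length-entries-column {k = suc k} ((_ ∷ []) ∷ U) = cong suc (length-entries-column U)

firstColumn-column : ∀ {m k} (U : Filling m (replicate k 1)) → firstColumn U ≡ entries U
firstColumn-column {k = zero} [] = refl
firstColumn-column {k = suc k} ((x ∷ []) ∷ U) = cong (x ∷_) (firstColumn-column U)

column-rowsWeaklyIncrease : ∀ {m k} (U : Filling m (replicate k 1)) → RowsWeaklyIncrease U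
column-rowsWeaklyIncrease {k = zero} [] = _
column-rowsWeaklyIncrease {k = suc k} ((_ ∷ []) ∷ U) = [-] , column-rowsWeaklyIncrease U

record LeastPositive {m} (v : Vec ℕ m) : Set where
  field
    index    : Fin m
    positive : 0 < lookup v index
    minimal  : ∀ i → 0 < lookup v i → index ≤ᶠ i

leastPositive : ∀ {m} (v : Vec ℕ m) → 0 < ∑ (lookup v) → LeastPositive v
leastPositive (suc _ ∷ v) _ = record { index = zero ; positive = s≤s z≤n ; minimal = λ _ _ → z≤n }
leastPositive (zero ∷ v) |v|>0 = record
  { index = suc index ; positive = positive ; minimal = λ { (suc i) p → s≤s (minimal i p) } }
  where open LeastPositive (leastPositive v |v|>0)

module HookTableaux {m : ℕ} (a k : ℕ) (v : Vec ℕ m) (|v|≡ : ∑ (lookup v) ≡ suc a + k) where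

  open LeastPositive (leastPositive v (subst (0 <_) (sym |v|≡) (s≤s z≤n)))
    renaming (index to μ; positive to μ-positive; minimal to μ-minimal)

  hook : List ℕ
  hook = suc a ∷ replicate k 1

  X : Vec (Fin 2) m
  X = support v Vec.[ μ ]≔ zero

  lookup-X-μ : lookup X μ ≡ zero
  lookup-X-μ = Vecₚ.lookup∘update μ (support v) zero

  lookup-X-≢ : ∀ {i} → i ≢ μ → lookup X i ≡ bit (lookup v i)
  lookup-X-≢ {i} i≢μ = trans (Vecₚ.lookup∘update′ i≢μ (support v) zero) (Vecₚ.lookup-map i bit v)

  HasContent : Filling m hook → Set
  HasContent U = IsImmaculate U × content U ≡ v

  column : Filling m hook → Vec (Fin 2) m
  column (_ ∷ col) = support (multiplicities (entries col))

  columnEntries : Vec (Fin 2) m → List (Fin m)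
  columnEntries w = fromMultiplicities (Vec.map toℕ w)

  rowMultiplicities : Vec (Fin 2) m → Vec ℕ m
  rowMultiplicities w = Vec.zipWith _∸_ v (multiplicities (μ ∷ columnEntries w))

  fromColumn : Vec (Fin 2) m → Filling m hook
  fromColumn w =
    (μ ∷ padRow μ a (fromMultiplicities (rowMultiplicities w))) ∷ padColumn μ k (columnEntries w)

  module Tableau {x r col} (T-ok : HasContent ((x ∷ r) ∷ col)) where

    E = entries col
    R = toList r

    row-sorted : Linked _≤ᶠ_ (x ∷ R)
    row-sorted = proj₁ (proj₁ (proj₁ T-ok))

    column-strict : Linked _<ᶠ_ (x ∷ E)
    column-strict = subst (λ ys → Linked _<ᶠ_ (x ∷ ys)) (firstColumn-column col) (proj₂ (proj₁ T-ok))

    v≡count : ∀ i → lookup v i ≡ count i (x ∷ R ++ E)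
    v≡count i = trans (cong (λ c → lookup c i) (sym (proj₂ T-ok))) (lookup-multiplicities (x ∷ R ++ E) i)

    x≡μ : x ≡ μ
    x≡μ = FinP.≤-antisym
      (All.lookup (bottomLeft-minimal (proj₁ T-ok)) (count-pos⇒∈ _ (subst (0 <_) (v≡count μ) μ-positive)))
      (μ-minimal x (subst (0 <_) (sym (trans (v≡count x) (count-≡ x (R ++ E)))) (s≤s z≤n)))

    count-μ-E : count μ E ≡ 0
    count-μ-E =
      count-below-all (subst (λ y → All (y <ᶠ_) E) x≡μ (Linked⇒All-head FinP.<-trans column-strict))

    count-E≤v : ∀ i → count i E ≤ lookup v i
    count-E≤v i = subst (count i E ≤_) (sym (trans (v≡count i) (count-++ i (x ∷ R) E)))
                        (ℕₚ.m≤n+m (count i E) (count i (x ∷ R)))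

    column-isSubset : IsSubsetOfSize X k (column ((x ∷ r) ∷ col))
    column-isSubset = below-X , size
      where
      lookup-column : ∀ i → lookup (column ((x ∷ r) ∷ col)) i ≡ bit (count i E)
      lookup-column i = trans (Vecₚ.lookup-map i bit (multiplicities E)) (cong bit (lookup-multiplicities E i))
      below-X : ∀ i → lookup (column ((x ∷ r) ∷ col)) i ≤ᶠ lookup X i
      below-X i with i ≟ᶠ μ
      ... | yes refl = subst (_≤ᶠ lookup X i) (sym (trans (lookup-column i) (cong bit count-μ-E))) z≤n
      ... | no i≢μ = subst₂ _≤ᶠ_ (sym (lookup-column i)) (sym (lookup-X-≢ i≢μ)) (bit-mono (count-E≤v i))
      size : weight (column ((x ∷ r) ∷ col)) ≡ k
      size = begin
        ∑ (lookup (Vec.map toℕ (support (multiplicities E))))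
          ≡⟨ cong (∑ ∘ lookup) (strict⇒toℕ-support-multiplicities (Linked.tail column-strict)) ⟩
        ∑ (lookup (multiplicities E)) ≡⟨ ∑-multiplicities E ⟩
        length E                      ≡⟨ length-entries-column col ⟩
        k                             ∎
        where open ≡-Reasoning

    fromColumn∘column : fromColumn (column ((x ∷ r) ∷ col)) ≡ (x ∷ r) ∷ col
    fromColumn∘column = begin
      fromColumn (column ((x ∷ r) ∷ col))
        ≡⟨ cong₂ (λ R′ E′ → (μ ∷ padRow μ a R′) ∷ padColumn μ k E′)
                 (trans (cong fromMultiplicities (sym row≡))
                        (fromMultiplicities-multiplicities (Linked.tail row-sorted)))
                 E′≡E ⟩
      (μ ∷ padRow μ a R) ∷ padColumn μ k E
        ≡⟨ cong₂ (λ y r′ → (y ∷ r′) ∷ padColumn μ k E) (sym x≡μ) (padRow-toList μ r) ⟩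
      (x ∷ r) ∷ padColumn μ k E
        ≡⟨ cong ((x ∷ r) ∷_) (padColumn-entries μ col) ⟩
      (x ∷ r) ∷ col ∎
      where
      open ≡-Reasoning
      E′≡E : columnEntries (column ((x ∷ r) ∷ col)) ≡ E
      E′≡E = trans (cong fromMultiplicities (strict⇒toℕ-support-multiplicities (Linked.tail column-strict)))
                   (fromMultiplicities-multiplicities (Linked.map ℕₚ.<⇒≤ (Linked.tail column-strict)))
      row≡ : multiplicities R ≡ rowMultiplicities (column ((x ∷ r) ∷ col))
      row≡ = multiplicities-≡ R λ i → sym (begin
        lookup (rowMultiplicities (column ((x ∷ r) ∷ col))) i
          ≡⟨ Vecₚ.lookup-zipWith _∸_ i v _ ⟩
        lookup v i ∸ lookup (multiplicities (μ ∷ columnEntries (column ((x ∷ r) ∷ col)))) i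
          ≡⟨ cong₂ _∸_ (trans (v≡count i) (cong (λ y → count i (y ∷ R ++ E)) x≡μ))
                       (trans (lookup-multiplicities (μ ∷ columnEntries (column ((x ∷ r) ∷ col))) i)
                              (cong (count i ∘ (μ ∷_)) E′≡E)) ⟩
        count i (μ ∷ R ++ E) ∸ count i (μ ∷ E)
          ≡⟨ cong (_∸ count i (μ ∷ E)) (count-∷-++ i μ R E) ⟩
        count i R + count i (μ ∷ E) ∸ count i (μ ∷ E)
          ≡⟨ ℕₚ.m+n∸n≡m (count i R) (count i (μ ∷ E)) ⟩
        count i R ∎)

  module FromColumn {w} (w-ok : IsSubsetOfSize X k w) where

    W = Vec.map toℕ w
    E = columnEntries w
    u = multiplicities (μ ∷ E)
    d = rowMultiplicities w
    D = fromMultiplicities d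

    W≤X : ∀ i → lookup W i ≤ toℕ (lookup X i)
    W≤X i = subst (_≤ toℕ (lookup X i)) (sym (Vecₚ.lookup-map i toℕ w)) (proj₁ w-ok i)

    W-μ : lookup W μ ≡ 0
    W-μ = ℕₚ.n≤0⇒n≡0 (subst (λ b → lookup W μ ≤ toℕ b) lookup-X-μ (W≤X μ))

    W≤v : ∀ {i} → i ≢ μ → lookup W i ≤ lookup v i
    W≤v {i} i≢μ =
      ℕₚ.≤-trans (subst (λ b → lookup W i ≤ toℕ b) (lookup-X-≢ i≢μ) (W≤X i)) (toℕ-bit≤ (lookup v i))

    count-E : ∀ i → count i E ≡ lookup W i
    count-E = count-fromMultiplicities W

    lookup-u : ∀ i → lookup u i ≡ count i (μ ∷ E)
    lookup-u = lookup-multiplicities (μ ∷ E)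

    u≤v : ∀ i → lookup u i ≤ lookup v i
    u≤v i with i ≟ᶠ μ
    ... | yes refl = subst (_≤ lookup v i) (sym u-μ) μ-positive
      where
      u-μ : lookup u i ≡ 1
      u-μ = trans (lookup-u i) (trans (count-≡ i E) (cong suc (trans (count-E i) W-μ)))
    ... | no i≢μ = subst (_≤ lookup v i) (sym u-i) (W≤v i≢μ)
      where
      u-i : lookup u i ≡ lookup W i
      u-i = trans (lookup-u i) (trans (count-≢ E (i≢μ ∘ sym)) (count-E i))

    lookup-d : ∀ i → lookup d i ≡ lookup v i ∸ lookup u i
    lookup-d i = Vecₚ.lookup-zipWith _∸_ i v u

    count-D : ∀ i → count i D ≡ lookup v i ∸ lookup u i
    count-D i = trans (count-fromMultiplicities d i) (lookup-d i)

    length-E : length E ≡ k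
    length-E = trans (length-fromMultiplicities W) (proj₂ w-ok)

    length-D : length D ≡ a
    length-D = trans (length-fromMultiplicities d) (ℕₚ.+-cancelʳ-≡ (suc k) (∑ (lookup d)) a (begin
      ∑ (lookup d) + suc k
        ≡⟨ cong (∑ (lookup d) +_) (trans (∑-multiplicities (μ ∷ E)) (cong suc length-E)) ⟨
      ∑ (lookup d) + ∑ (lookup u)
        ≡⟨ ∑-distrib-+ (lookup d) (lookup u) ⟨
      ∑ (λ i → lookup d i + lookup u i)
        ≡⟨ sum-cong-≗ (λ i → trans (cong (_+ lookup u i) (lookup-d i)) (ℕₚ.m∸n+n≡m (u≤v i))) ⟩
      ∑ (lookup v)                      ≡⟨ |v|≡ ⟩
      suc a + k                         ≡⟨ ℕₚ.+-suc a k ⟨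
      a + suc k                         ∎))
      where open ≡-Reasoning

    entries-fromColumn : entries (fromColumn w) ≡ μ ∷ D ++ E
    entries-fromColumn =
      cong₂ (λ D′ E′ → μ ∷ D′ ++ E′) (toList-padRow μ D length-D) (entries-padColumn μ E length-E)

    content-fromColumn : content (fromColumn w) ≡ v
    content-fromColumn =
      trans (cong multiplicities entries-fromColumn) (multiplicities-≡ (μ ∷ D ++ E) λ i → begin
      count i (μ ∷ D ++ E)                   ≡⟨ count-∷-++ i μ D E ⟩
      count i D + count i (μ ∷ E)            ≡⟨ cong₂ _+_ (count-D i) (sym (lookup-u i)) ⟩
      lookup v i ∸ lookup u i + lookup u i   ≡⟨ ℕₚ.m∸n+n≡m (u≤v i) ⟩
      lookup v i                             ∎)
      where open ≡-Reasoning

    row-sorted : Linked _≤ᶠ_ (μ ∷ toList (padRow μ a D))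
    row-sorted = subst (λ ys → Linked _≤ᶠ_ (μ ∷ ys)) (sym (toList-padRow μ D length-D))
      (All-head∷Linked (All.tabulate μ≤) (fromMultiplicities-sorted d))
      where
      μ≤ : ∀ {y} → y ∈ D → μ ≤ᶠ y
      μ≤ {y} y∈D = μ-minimal y (ℕₚ.<-≤-trans (subst (0 <_) (count-D y) (∈⇒count-pos y∈D))
                                              (ℕₚ.m∸n≤m (lookup v y) (lookup u y)))

    column-strict : Linked _<ᶠ_ (firstColumn (fromColumn w))
    column-strict = subst (λ ys → Linked _<ᶠ_ (μ ∷ ys))
      (sym (trans (firstColumn-column (padColumn μ k E)) (entries-padColumn μ E length-E)))
      (All-head∷Linked (All.tabulate μ<) (fromMultiplicities-strict W W≤1))
      where
      W≤1 : ∀ i → lookup W i ≤ 1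
      W≤1 i = subst (_≤ 1) (sym (Vecₚ.lookup-map i toℕ w)) (ℕ.s≤s⁻¹ (FinP.toℕ<n (lookup w i)))
      μ< : ∀ {y} → y ∈ E → μ <ᶠ y
      μ< {y} y∈E = FinP.≤∧≢⇒< (μ-minimal y (ℕₚ.<-≤-trans W-y-positive (W≤v y≢μ))) (y≢μ ∘ sym)
        where
        W-y-positive : 0 < lookup W y
        W-y-positive = subst (0 <_) (count-E y) (∈⇒count-pos y∈E)
        y≢μ : y ≢ μ
        y≢μ refl = ℕₚ.<-irrefl (sym W-μ) W-y-positive

    fromColumn-hasContent : HasContent (fromColumn w)
    fromColumn-hasContent = ((row-sorted , column-rowsWeaklyIncrease _) , column-strict) , content-fromColumn

    column∘fromColumn : column (fromColumn w) ≡ w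
    column∘fromColumn = begin
      support (multiplicities (entries (padColumn μ k E)))
        ≡⟨ cong (support ∘ multiplicities) (entries-padColumn μ E length-E) ⟩
      support (multiplicities E) ≡⟨ cong support (multiplicities-fromMultiplicities W) ⟩
      support W                  ≡⟨ support-toℕ w ⟩
      w                          ∎
      where open ≡-Reasoning

  weight-X : weight X ≡ weight (support v) ∸ 1
  weight-X = cong (_∸ 1) (sym (begin
    weight (support v)
      ≡⟨ weight-[]≔zero (support v) μ ⟩
    toℕ (lookup (support v) μ) + weight X
      ≡⟨ cong (λ b → toℕ b + weight X) (Vecₚ.lookup-map μ bit v) ⟩
    toℕ (bit (lookup v μ)) + weight X
      ≡⟨ cong (λ c → toℕ (bit c) + weight X) (ℕₚ.suc-pred (lookup v μ) {{ℕ.>-nonZero μ-positive}}) ⟨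
    suc (weight X) ∎))
    where open ≡-Reasoning

  dualImmaculate-hook : dualImmaculate hook m v ≡ (weight (support v) ∸ 1) C k
  dualImmaculate-hook = begin
    dualImmaculate hook m v
      ≡⟨ length-filter-≡-bijection _ (isSubsetOfSize? X k) (allFillings-unique m hook) (allVecs-unique 2 m)
           ∈-allFillings ∈-allVecs column fromColumn
           (λ { {(_ ∷ _) ∷ _} T-ok → Tableau.column-isSubset T-ok })
           (λ {w} w-ok → FromColumn.fromColumn-hasContent {w} w-ok)
           (λ { {(_ ∷ _) ∷ _} T-ok → Tableau.fromColumn∘column T-ok })
           (λ {w} w-ok → FromColumn.column∘fromColumn {w} w-ok) ⟩
    length (subsetsOfSize X k)                         ≡⟨ #subsetsOfSize X k ⟩
    weight X C k                                       ≡⟨ cong (_C k) weight-X ⟩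
    (weight (support v) ∸ 1) C k                       ∎
    where open ≡-Reasoning

permute : ∀ {m} → Permutation′ m → Vec ℕ m → Vec ℕ m
permute σ v = tabulate (λ i → lookup v (σ ⟨$⟩ʳ i))

∑-map-permute : ∀ {m} (f : ℕ → ℕ) (v : Vec ℕ m) σ →
  ∑ (λ i → f (lookup v i)) ≡ ∑ (λ i → f (lookup (permute σ v) i))
∑-map-permute f v σ = trans (sum-permute (λ i → f (lookup v i)) σ)
  (sym (sum-cong-≗ (λ i → cong f (Vecₚ.lookup∘tabulate (λ i → lookup v (σ ⟨$⟩ʳ i)) i))))

hook-symmetric : ∀ a k → IsSymmetric (dualImmaculate (suc a ∷ replicate k 1))
hook-symmetric a k m v σ with ∑ (lookup v) ℕ.≟ suc a + k
... | yes |v|≡ = begin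
  dualImmaculate (suc a ∷ replicate k 1) m v
    ≡⟨ HookTableaux.dualImmaculate-hook a k v |v|≡ ⟩
  (weight (support v) ∸ 1) C k
    ≡⟨ cong (λ s → (s ∸ 1) C k) support-size≡ ⟩
  (weight (support v′) ∸ 1) C k
    ≡⟨ HookTableaux.dualImmaculate-hook a k v′ (trans (sym degree≡) |v|≡) ⟨
  dualImmaculate (suc a ∷ replicate k 1) m v′ ∎
  where
  open ≡-Reasoning
  v′ = permute σ v
  degree≡ : ∑ (lookup v) ≡ ∑ (lookup v′)
  degree≡ = ∑-map-permute (λ c → c) v σ
  support-size≡ : weight (support v) ≡ weight (support v′)
  support-size≡ = trans (weight-support v) (trans (∑-map-permute (toℕ ∘ bit) v σ) (sym (weight-support v′)))
... | no |v|≢ = trans (dualImmaculate-≢-degree hook v (|v|≢ ∘ to-hook-degree))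
  (sym (dualImmaculate-≢-degree hook (permute σ v)
         (|v|≢ ∘ to-hook-degree ∘ trans (∑-map-permute (λ c → c) v σ))))
  where
  hook = suc a ∷ replicate k 1
  to-hook-degree : ∀ {d} → d ≡ sum hook → d ≡ suc a + k
  to-hook-degree d≡ = trans d≡ (cong (suc a +_) (sum-replicate-1 k))

sum-map-pred : ∀ β → All (0 <_) β → sum (map ℕ.pred β) + length β ≡ sum β
sum-map-pred [] [] = refl
sum-map-pred (suc b ∷ β) (_ ∷ β>0) = trans (ℕₚ.+-suc (b + sum (map ℕ.pred β)) (length β))
  (cong suc (trans (ℕₚ.+-assoc b _ _) (cong (b +_) (sum-map-pred β β>0))))

nonHook-length<sum : ∀ β → All (0 <_) β → β ≢ replicate (length β) 1 → length β < sum β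
nonHook-length<sum [] [] β≢ = ⊥-elim (β≢ refl)
nonHook-length<sum (suc zero ∷ β) (_ ∷ β>0) β≢ = s≤s (nonHook-length<sum β β>0 (β≢ ∘ cong (1 ∷_)))
nonHook-length<sum (suc (suc b) ∷ β) (_ ∷ β>0) _ =
  s≤s (s≤s (ℕₚ.≤-trans (subst (length β ≤_) (sum-map-pred β β>0) (ℕₚ.m≤n+m (length β) _))
                       (ℕₚ.m≤n+m (sum β) b)))

module Staircase (k : ℕ) where

  top : Fin (suc k)
  top = fromℕ k

  toppedRow : Fin (suc k) → (b : ℕ) → Vec (Fin (suc k)) b
  toppedRow c zero = []
  toppedRow c (suc b) = c ∷ Vec.replicate b top

  staircase : (β : List ℕ) → Vec (Fin (suc k)) (length β) → Filling (suc k) β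
  staircase [] [] = []
  staircase (b ∷ β) (c ∷ cs) = toppedRow c b ∷ staircase β cs

  toppedRow-sorted : ∀ c b → Linked _≤ᶠ_ (toList (toppedRow c b))
  toppedRow-sorted c zero = []
  toppedRow-sorted c (suc zero) = [-]
  toppedRow-sorted c (suc (suc b)) = FinP.≤fromℕ c ∷ toppedRow-sorted top (suc b)

  staircase-rows : ∀ β cs → RowsWeaklyIncrease (staircase β cs)
  staircase-rows [] [] = _
  staircase-rows (b ∷ β) (c ∷ cs) = toppedRow-sorted c b , staircase-rows β cs

  firstColumn-staircase : ∀ {β} cs → All (0 <_) β → firstColumn (staircase β cs) ≡ toList cs
  firstColumn-staircase [] [] = refl
  firstColumn-staircase {suc b ∷ β} (c ∷ cs) (_ ∷ β>0) = cong (c ∷_) (firstColumn-staircase cs β>0)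

  count-staircase : ∀ {β} cs → All (0 <_) β → ∀ i →
    count i (entries (staircase β cs)) ≡ count i (toList cs) + count i (replicate (sum (map ℕ.pred β)) top)
  count-staircase [] [] i = refl
  count-staircase {suc b ∷ β} (c ∷ cs) (_ ∷ β>0) i = begin
    count i (c ∷ toList (Vec.replicate b top) ++ entries (staircase β cs))
      ≡⟨ count-∷-++ i c _ _ ⟩
    count i (toList (Vec.replicate b top)) + count i (c ∷ entries (staircase β cs))
      ≡⟨ cong₂ _+_ (cong (count i) (Vecₚ.toList-replicate b top)) (count-++ i (c ∷ []) _) ⟩
    p + (a + count i (entries (staircase β cs)))
      ≡⟨ cong (λ z → p + (a + z)) (count-staircase cs β>0 i) ⟩
    p + (a + (s + q))
      ≡⟨ x∙yz≈y∙xz p a (s + q) ⟩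
    a + (p + (s + q))
      ≡⟨ cong (a +_) (x∙yz≈y∙xz p s q) ⟩
    a + (s + (p + q))
      ≡⟨ ℕₚ.+-assoc a s (p + q) ⟨
    (a + s) + (p + q)
      ≡⟨ cong₂ _+_ (count-++ i (c ∷ []) (toList cs)) (count-replicate-+ i top b (sum (map ℕ.pred β))) ⟨
    count i (c ∷ toList cs) + count i (replicate (b + sum (map ℕ.pred β)) top) ∎
    where
    open ≡-Reasoning
    a = count i (c ∷ [])
    s = count i (toList cs)
    p = count i (replicate b top)
    q = count i (replicate (sum (map ℕ.pred β)) top)

module ShortBottomRow {n a r₀ : ℕ} {rest : List ℕ} (composition : IsCompositionOf n (suc a ∷ r₀ ∷ rest))
                      (short : suc a < n ∸ suc (length rest)) where

  k : ℕ
  k = suc (length rest)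

  α : List ℕ
  α = suc a ∷ r₀ ∷ rest

  open Staircase k

  v : Vec ℕ (suc k)
  v = (n ∸ k) ∷ Vec.replicate k 1

  σ : Permutation′ (suc k)
  σ = transpose zero top

  no-tableau : (U : Filling (suc k) α) → ¬ (IsImmaculate U × content U ≡ v)
  no-tableau ((x ∷ r) ∷ U) (((_ , rows) , column-strict) , content≡v) = ℕₚ.<⇒≱ short (begin
    n ∸ k                                              ≡⟨ cong (λ c → lookup c zero) content≡v ⟨
    count zero (x ∷ toList r ++ entries U)             ≡⟨ count-++ zero (x ∷ toList r) (entries U) ⟩
    count zero (x ∷ toList r) + count zero (entries U) ≡⟨ cong (count zero (x ∷ toList r) +_) none-above ⟩
    count zero (x ∷ toList r) + 0                      ≡⟨ ℕₚ.+-identityʳ _ ⟩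
    count zero (x ∷ toList r)                          ≤⟨ Listₚ.length-filter (_≟ᶠ zero) (x ∷ toList r) ⟩
    suc (length (toList r))                            ≡⟨ cong suc (Vecₚ.length-toList r) ⟩
    suc a                                              ∎)
    where
    open ℕₚ.≤-Reasoning
    none-above : count zero (entries U) ≡ 0
    none-above = count-below-all (All.map (ℕₚ.≤-<-trans z≤n) (entries-above-bottomLeft U rows column-strict))

  extra : ℕ
  extra = sum (map ℕ.pred α)

  suc-extra : suc extra ≡ n ∸ k
  suc-extra = begin
    suc extra         ≡⟨ ℕₚ.m+n∸n≡m (suc extra) k ⟨
    suc extra + k ∸ k ≡⟨ cong (_∸ k) (ℕₚ.+-suc extra k) ⟨
    extra + suc k ∸ k ≡⟨ cong (_∸ k) (sum-map-pred α (proj₁ composition)) ⟩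
    sum α ∸ k         ≡⟨ cong (_∸ k) (proj₂ composition) ⟩
    n ∸ k             ∎
    where open ≡-Reasoning

  witness : Filling (suc k) α
  witness = staircase α (Vec.allFin (suc k))

  lookup-v-σ : ∀ i → suc (count i (replicate extra top)) ≡ lookup v (σ ⟨$⟩ʳ i)
  lookup-v-σ zero =
    trans (cong suc (count-replicate-≢ extra (λ ()))) (sym (Vecₚ.lookup-replicate (fromℕ (length rest)) 1))
  -- σ ⟨$⟩ʳ suc j tests suc j ≟ top, which reduces to j ≟ fromℕ (length rest).
  lookup-v-σ (suc j) with j ≟ᶠ fromℕ (length rest)
  ... | yes refl = trans (cong suc (count-replicate-≡ top extra)) suc-extra
  ... | no j≢top = trans (cong suc (count-replicate-≢ extra (j≢top ∘ sym ∘ suc-injective)))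
                         (sym (Vecₚ.lookup-replicate j 1))

  witness-ok : IsImmaculate witness × content witness ≡ permute σ v
  witness-ok = ( (staircase-rows α (Vec.allFin (suc k))
               , subst (Linked _<ᶠ_) (sym (firstColumn-staircase (Vec.allFin (suc k)) (proj₁ composition)))
                       (allFin-strict (suc k)))
               , multiplicities-≡ (entries witness) λ i → begin
    count i (entries witness)
      ≡⟨ count-staircase (Vec.allFin (suc k)) (proj₁ composition) i ⟩
    count i (toList (Vec.allFin (suc k))) + count i (replicate extra top)
      ≡⟨ cong (_+ count i (replicate extra top)) (count-allFin (suc k) i) ⟩
    suc (count i (replicate extra top))
      ≡⟨ lookup-v-σ i ⟩
    lookup v (σ ⟨$⟩ʳ i)
      ≡⟨ Vecₚ.lookup∘tabulate (λ i → lookup v (σ ⟨$⟩ʳ i)) i ⟨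
    lookup (permute σ v) i ∎)
    where open ≡-Reasoning

  not-symmetric : ¬ IsSymmetric (dualImmaculate α)
  not-symmetric symmetric = ℕₚ.n≮0 (begin-strict
    0                                      <⟨ Listₚ.filter-some _ (Any.map witness-is (∈-allFillings witness)) ⟩
    dualImmaculate α (suc k) (permute σ v) ≡⟨ symmetric (suc k) v σ ⟨
    dualImmaculate α (suc k) v             ≡⟨ length-filter-none _ (All.universal no-tableau (allFillings _ α)) ⟩
    0                                      ∎)
    where
    open ℕₚ.≤-Reasoning
    witness-is : ∀ {U} → witness ≡ U → IsImmaculate U × content U ≡ permute σ v
    witness-is refl = witness-ok

nonHook-not-symmetric : ∀ {n p} rest → IsCompositionOf n (p ∷ rest) → rest ≢ replicate (length rest) 1 →
  ¬ IsSymmetric (dualImmaculate (p ∷ rest))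
nonHook-not-symmetric [] _ rest≢ = ⊥-elim (rest≢ refl)
nonHook-not-symmetric {n} {suc a} (r₀ ∷ rest) composition@(_ ∷ rest>0 , sum≡n) rest≢ =
  ShortBottomRow.not-symmetric composition (ℕₚ.m+n≤o⇒m≤o∸n (suc (suc a)) (begin
    suc (suc a + length (r₀ ∷ rest)) ≡⟨ ℕₚ.+-suc (suc a) (length (r₀ ∷ rest)) ⟨
    suc a + suc (length (r₀ ∷ rest))
      ≤⟨ ℕₚ.+-monoʳ-≤ (suc a) (nonHook-length<sum (r₀ ∷ rest) rest>0 rest≢) ⟩
    suc a + sum (r₀ ∷ rest)          ≡⟨ sum≡n ⟩
    n                                ∎))
  where open ℕₚ.≤-Reasoning

hook-of-symmetric : ∀ {n k α} → IsCompositionOf n α → length α ≡ suc k →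
  IsSymmetric (dualImmaculate α) → α ≡ (n ∸ k) ∷ replicate k 1
hook-of-symmetric {n} {k} {p ∷ rest} composition@(_ , sum≡n) len symmetric
  with Listₚ.≡-dec ℕ._≟_ rest (replicate k 1)
... | no rest≢ = ⊥-elim (nonHook-not-symmetric rest composition
                          (rest≢ ∘ subst (λ l → rest ≡ replicate l 1) (ℕₚ.suc-injective len)) symmetric)
... | yes refl = cong (_∷ replicate k 1) (begin
  p                           ≡⟨ ℕₚ.m+n∸n≡m p k ⟨
  p + k ∸ k                   ≡⟨ cong (λ s → p + s ∸ k) (sum-replicate-1 k) ⟨
  p + sum (replicate k 1) ∸ k ≡⟨ cong (_∸ k) sum≡n ⟩
  n ∸ k                       ∎)
  where open ≡-Reasoning

mainTheorem14 : (n k : ℕ) (α : List ℕ) → IsCompositionOf n α → length α ≡ suc k →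
    IsSymmetric (dualImmaculate α) ⇔ (α ≡ (n ∸ k) ∷ replicate k 1)
mainTheorem14 n k α composition len = mk⇔ (hook-of-symmetric composition len) hook-is-symmetric
  where
  hook-is-symmetric : α ≡ (n ∸ k) ∷ replicate k 1 → IsSymmetric (dualImmaculate α)
  hook-is-symmetric refl with n ∸ k | proj₁ composition
  ... | zero  | () ∷ _
  ... | suc a | _ = hook-symmetric a k
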